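{- Let $(a,b,c,d)\in\mathbb R^4$ be a Descartes quadruple which is a root quadruple in the ordered form $a\le 0\le b\le c\le d$, $a+b+c\ge d$. Then for every $i\in\{2,3,4\}$, $S_i^\perp(a,b,c,d)^t$ is, after reordering its coordinates, again a root quadruple.
   Context: A Descartes quadruple is a vector $(y_0,y_1,y_2,y_3)$ with $(y_0+y_1+y_2+y_3)^2-2(y_0^2+y_1^2+y_2^2+y_3^2)=0$. It is a root quadruple if, after reordering its coordinates as $(a,b,c,d)$, $a\le0\le b\le c\le d$ and $a+b+c\ge d$. The matrices are $S_2^\perp=\begin{pmatrix}1&2&0&0\\0&-1&0&0\\0&2&1&0\\0&2&0&1\end{pmatrix}$, $S_3^\perp=\begin{pmatrix}1&0&2&0\\0&1&2&0\\0&0&-1&0\\0&0&2&1\end{pmatrix}$, $S_4^\perp=\begin{pmatrix}1&0&0&2\\0&1&0&2\\0&0&1&2\\0&0&0&-1\end{pmatrix}$. -}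

module Defs where

open import Level using (Level; _⊔_)
open import Algebra.Bundles using (CommutativeRing)
open import Relation.Binary.Structures using (IsTotalOrder)
open import Relation.Nullary using (¬_)
open import Data.Product using (Σ; _×_; ∃)
open import Data.Fin using (Fin; zero; suc)
open import Data.Fin.Permutation using (Permutation′; _⟨$⟩ʳ_)

-- An ordered field (ℝ is one).  Carrier equality is the setoid ≈.
record OrderedField (c ℓ₁ ℓ₂ : Level) : Set (Level.suc (c ⊔ ℓ₁ ⊔ ℓ₂)) where
  field
    commutativeRing : CommutativeRing c ℓ₁
  open CommutativeRing commutativeRing public
  infix 4 _≤_
  field
    _≤_           : Carrier → Carrier → Set ℓ₂
    isTotalOrder  : IsTotalOrder _≈_ _≤_
    +-mono-≤      : ∀ {x y} z → x ≤ y → x + z ≤ y + z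
    *-nonneg      : ∀ {x y} → 0# ≤ x → 0# ≤ y → 0# ≤ x * y
    0≉1           : ¬ (0# ≈ 1#)
    inverse       : ∀ x → ¬ (x ≈ 0#) → Σ Carrier (λ y → x * y ≈ 1#)

module _ {c ℓ₁ ℓ₂ : Level} (F : OrderedField c ℓ₁ ℓ₂) where
  open OrderedField F using (Carrier; _≈_; _≤_; _+_; _*_; _-_; -_; 0#; 1#)

  Vec4 : Set c
  Vec4 = Fin 4 → Carrier

  Mat4 : Set c
  Mat4 = Fin 4 → Fin 4 → Carrier

  two : Carrier
  two = 1# + 1#

  _·_ : Mat4 → Vec4 → Vec4
  (M · v) i = M i zero * v zero + M i (suc zero) * v (suc zero)
            + M i (suc (suc zero)) * v (suc (suc zero))
            + M i (suc (suc (suc zero))) * v (suc (suc (suc zero)))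

  Descartes : Vec4 → Set ℓ₁
  Descartes y =
    (s * s) - two * (y0 * y0 + y1 * y1 + y2 * y2 + y3 * y3) ≈ 0#
    where
      y0 = y zero
      y1 = y (suc zero)
      y2 = y (suc (suc zero))
      y3 = y (suc (suc (suc zero)))
      s = y0 + y1 + y2 + y3

  OrderedRoot : Carrier → Carrier → Carrier → Carrier → Set ℓ₂
  OrderedRoot a b c d =
    a ≤ 0# × 0# ≤ b × b ≤ c × c ≤ d × d ≤ a + b + c

  RootQuadruple : Vec4 → Set (ℓ₁ ⊔ ℓ₂)
  RootQuadruple y = Descartes y × ∃ λ (σ : Permutation′ 4) →
    OrderedRoot (y (σ ⟨$⟩ʳ zero)) (y (σ ⟨$⟩ʳ suc zero))
                (y (σ ⟨$⟩ʳ suc (suc zero))) (y (σ ⟨$⟩ʳ suc (suc (suc zero))))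

  quad : Carrier → Carrier → Carrier → Carrier → Vec4
  quad a b c d zero = a
  quad a b c d (suc zero) = b
  quad a b c d (suc (suc zero)) = c
  quad a b c d (suc (suc (suc zero))) = d

  -- the matrices S_2^⊥, S_3^⊥, S_4^⊥ of the paper, written row by row;
  -- k : Fin 3 with k = 0,1,2 standing for i = 2,3,4.
  m1 : Carrier
  m1 = - 1#

  rows : Carrier → Carrier → Carrier → Carrier → Fin 4 → Carrier
  rows x0 x1 x2 x3 zero = x0
  rows x0 x1 x2 x3 (suc zero) = x1
  rows x0 x1 x2 x3 (suc (suc zero)) = x2
  rows x0 x1 x2 x3 (suc (suc (suc zero))) = x3

  Sperp : Fin 3 → Mat4
  Sperp zero zero                      = rows 1# two 0# 0#
  Sperp zero (suc zero)                = rows 0# m1 0# 0#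
  Sperp zero (suc (suc zero))          = rows 0# two 1# 0#
  Sperp zero (suc (suc (suc zero)))    = rows 0# two 0# 1#
  Sperp (suc zero) zero                   = rows 1# 0# two 0#
  Sperp (suc zero) (suc zero)             = rows 0# 1# two 0#
  Sperp (suc zero) (suc (suc zero))       = rows 0# 0# m1 0#
  Sperp (suc zero) (suc (suc (suc zero))) = rows 0# 0# two 1#
  Sperp (suc (suc zero)) zero                   = rows 1# 0# 0# two
  Sperp (suc (suc zero)) (suc zero)             = rows 0# 1# 0# two
  Sperp (suc (suc zero)) (suc (suc zero))       = rows 0# 0# 1# two
  Sperp (suc (suc zero)) (suc (suc (suc zero))) = rows 0# 0# 0# m1

{-# OPTIONS --safe #-}
-- Moving coordinate i to the front turns S_i^⊥ into the single map
-- (t, p, q, r) ↦ (-t, p + 2t, q + 2t, r + 2t).  This map preserves the Descartes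
-- form, which is symmetric, so the Descartes condition survives.  It produces an
-- ordered root quadruple whenever 0 ≤ t, 0 ≤ p + 2t, p ≤ q ≤ r and r ≤ p + q + t;
-- for a root quadruple (a, b, c, d) and t ∈ {b, c, d} these follow from the order
-- conditions together with a + b ≥ d - c ≥ 0.
module Submission where

open import Defs
open import Level using (Level)
open import Function using (_∘_)
open import Data.Fin using (Fin; zero; suc)
open import Data.Fin.Permutation using (Permutation′; _⟨$⟩ʳ_; insert; id)
open import Data.Product using (_,_; _×_)
open import Relation.Binary.Bundles using (Poset)
open import Relation.Binary.Structures using (IsTotalOrder)
import Algebra.Properties.CommutativeMonoid.Sum as MonoidSum
import Algebra.Properties.CommutativeSemigroup as CommutativeSemigroupProperties
import Algebra.Properties.Group as GroupProperties
import Algebra.Properties.Ring as RingProperties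
import Algebra.Solver.Ring.NaturalCoefficients.Default as SemiringSolver
import Relation.Binary.Reasoning.PartialOrder as PosetReasoning

-- Lists coordinate k + 1 first and the other three in their original order.
toFront : Fin 3 → Permutation′ 4
toFront k = insert zero (suc k) id

module _ {c ℓ₁ ℓ₂ : Level} (F : OrderedField c ℓ₁ ℓ₂) where
  open OrderedField F hiding (zero)
  open IsTotalOrder isTotalOrder using (isPartialOrder)
    renaming (refl to ≤-refl; trans to ≤-trans; reflexive to ≤-reflexive)
  open GroupProperties +-group using (x∙y⁻¹≈ε⇒x≈y; x≈y⇒x∙y⁻¹≈ε; ∙-cancelʳ)
  open CommutativeSemigroupProperties +-commutativeSemigroup using (xy∙z≈xz∙y)
  open RingProperties ring using (-1*x≈-x)
  open SemiringSolver commutativeSemiring using (solve; _:=_; _:+_; _:*_; con; Polynomial)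
  open MonoidSum +-commutativeMonoid using (sum; sum-permute)

  poset : Poset c ℓ₁ ℓ₂
  poset = record { isPartialOrder = isPartialOrder }

  open PosetReasoning poset

  ≤-resp₂ : ∀ {x x′ y y′} → x ≈ x′ → y ≈ y′ → x ≤ y → x′ ≤ y′
  ≤-resp₂ x≈x′ y≈y′ x≤y = ≤-trans (≤-reflexive (sym x≈x′)) (≤-trans x≤y (≤-reflexive y≈y′))

  +-monoˡ-≤ : ∀ z {x y} → x ≤ y → z + x ≤ z + y
  +-monoˡ-≤ z {x} {y} x≤y = begin
    z + x  ≈⟨ +-comm z x ⟩
    x + z  ≤⟨ +-mono-≤ z x≤y ⟩
    y + z  ≈⟨ +-comm y z ⟩
    z + y  ∎

  +-mono₂-≤ : ∀ {x y u v} → x ≤ y → u ≤ v → x + u ≤ y + v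
  +-mono₂-≤ {y = y} {u = u} x≤y u≤v = ≤-trans (+-mono-≤ u x≤y) (+-monoˡ-≤ y u≤v)

  +-cancelʳ-≤ : ∀ z {x y} → x + z ≤ y + z → x ≤ y
  +-cancelʳ-≤ z {x} {y} le = begin
    x              ≈⟨ cancel x ⟨
    x + z + - z    ≤⟨ +-mono-≤ (- z) le ⟩
    y + z + - z    ≈⟨ cancel y ⟩
    y              ∎
    where
    cancel : ∀ w → w + z + - z ≈ w
    cancel w = trans (+-assoc w z (- z)) (trans (+-congˡ (-‿inverseʳ z)) (+-identityʳ w))

  neg-nonpos : ∀ {t} → 0# ≤ t → - t ≤ 0#
  neg-nonpos {t} 0≤t = begin
    - t        ≈⟨ +-identityˡ (- t) ⟨
    0# + - t   ≤⟨ +-mono-≤ (- t) 0≤t ⟩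
    t + - t    ≈⟨ -‿inverseʳ t ⟩
    0#         ∎

  -- The semiring solver knows no negation; identities involving - t are
  -- proved with a fresh variable n for - t, modulo multiples of t + n.
  ≈-modulo-null : ∀ {u x y v w} → u ≈ 0# → x + u * v ≈ y + u * w → x ≈ y
  ≈-modulo-null {u} {x} {y} {v} {w} u≈0 eq = begin-equality
    x            ≈⟨ +-identityʳ x ⟨
    x + 0#       ≈⟨ +-congˡ (trans (*-congʳ u≈0) (zeroˡ v)) ⟨
    x + u * v    ≈⟨ eq ⟩
    y + u * w    ≈⟨ +-congˡ (trans (*-congʳ u≈0) (zeroˡ w)) ⟩
    y + 0#       ≈⟨ +-identityʳ y ⟩
    y            ∎

  Σ₄ : Vec4 F → Carrier
  Σ₄ y = y zero + y (suc zero) + y (suc (suc zero)) + y (suc (suc (suc zero)))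

  squares : Vec4 F → Vec4 F
  squares y i = y i * y i

  Σ₄≈sum : ∀ y → Σ₄ y ≈ sum y
  Σ₄≈sum y = solve 4 (λ a b c d → a :+ b :+ c :+ d := a :+ (b :+ (c :+ (d :+ con 0)))) refl
    (y zero) (y (suc zero)) (y (suc (suc zero))) (y (suc (suc (suc zero))))

  Descartes⇒ : ∀ {y : Vec4 F} → Descartes F y → Σ₄ y * Σ₄ y ≈ two F * Σ₄ (squares y)
  Descartes⇒ = x∙y⁻¹≈ε⇒x≈y _ _

  Descartes⇐ : ∀ {y : Vec4 F} → Σ₄ y * Σ₄ y ≈ two F * Σ₄ (squares y) → Descartes F y
  Descartes⇐ = x≈y⇒x∙y⁻¹≈ε

  Descartes-resp-sums : ∀ (y z : Vec4 F) → sum y ≈ sum z → sum (squares y) ≈ sum (squares z) →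
                        Descartes F y → Descartes F z
  Descartes-resp-sums y z Σy≈Σz Σy²≈Σz² = Descartes⇐ {z} ∘ transport ∘ Descartes⇒ {y}
    where
    sums : ∀ (u v : Vec4 F) → sum u ≈ sum v → Σ₄ u ≈ Σ₄ v
    sums u v eq = trans (Σ₄≈sum u) (trans eq (sym (Σ₄≈sum v)))
    transport : Σ₄ y * Σ₄ y ≈ two F * Σ₄ (squares y) → Σ₄ z * Σ₄ z ≈ two F * Σ₄ (squares z)
    transport eq = trans (*-cong (sym (sums y z Σy≈Σz)) (sym (sums y z Σy≈Σz)))
                     (trans eq (*-congˡ (sums (squares y) (squares z) Σy²≈Σz²)))

  Descartes-cong : ∀ {y z : Vec4 F} → (∀ i → y i ≈ z i) → Descartes F y → Descartes F z
  Descartes-cong {y} {z} y≈z =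
    Descartes-resp-sums y z (sum-cong y≈z) (sum-cong (λ i → *-cong (y≈z i) (y≈z i)))
    where open MonoidSum +-commutativeMonoid using () renaming (sum-cong-≋ to sum-cong)

  Descartes-permute : (σ : Permutation′ 4) (y : Vec4 F) →
                      Descartes F y → Descartes F (y ∘ (σ ⟨$⟩ʳ_))
  Descartes-permute σ y =
    Descartes-resp-sums y (y ∘ (σ ⟨$⟩ʳ_)) (sum-permute y σ) (sum-permute (squares y) σ)

  Descartes-unpermute : (σ : Permutation′ 4) (y : Vec4 F) →
                        Descartes F (y ∘ (σ ⟨$⟩ʳ_)) → Descartes F y
  Descartes-unpermute σ y =
    Descartes-resp-sums (y ∘ (σ ⟨$⟩ʳ_)) y (sym (sum-permute y σ)) (sym (sum-permute (squares y) σ))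

  reflect₀ : Vec4 F → Vec4 F
  reflect₀ w =
    quad F (- t) (w (suc zero) + (t + t)) (w (suc (suc zero)) + (t + t)) (w (suc (suc (suc zero))) + (t + t))
    where t = w zero

  -- With n = - t, the two Descartes forms differ by (t + n) (2 (p + q + r) + 13 t - n).
  Descartes-reflect₀ : ∀ w → Descartes F w → Descartes F (reflect₀ w)
  Descartes-reflect₀ w D = Descartes⇐ {w′} (∙-cancelʳ (two F * Σ₄ (squares w)) _ _ (begin-equality
    Σ₄ w′ * Σ₄ w′ + two F * Σ₄ (squares w)
      ≈⟨ ≈-modulo-null (-‿inverseʳ t) (solve 5 (λ t p q r n →
             sumSquaredᴾ n (p :+ (t :+ t)) (q :+ (t :+ t)) (r :+ (t :+ t)) :+ twiceSquaresᴾ t p q r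
               :+ (t :+ n) :* n
          := twiceSquaresᴾ n (p :+ (t :+ t)) (q :+ (t :+ t)) (r :+ (t :+ t)) :+ sumSquaredᴾ t p q r
               :+ (t :+ n) :* (con 2 :* (p :+ q :+ r) :+ con 13 :* t))
           refl t p q r (- t)) ⟩
    two F * Σ₄ (squares w′) + Σ₄ w * Σ₄ w
      ≈⟨ +-congˡ (Descartes⇒ {w} D) ⟩
    two F * Σ₄ (squares w′) + two F * Σ₄ (squares w)
      ∎))
    where
    w′ : Vec4 F
    w′ = reflect₀ w
    t p q r : Carrier
    t = w zero
    p = w (suc zero)
    q = w (suc (suc zero))
    r = w (suc (suc (suc zero)))
    sumSquaredᴾ twiceSquaresᴾ : ∀ {m} → (a b c d : Polynomial m) → Polynomial m
    sumSquaredᴾ a b c d = (a :+ b :+ c :+ d) :* (a :+ b :+ c :+ d)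
    twiceSquaresᴾ a b c d = con 2 :* (a :* a :+ b :* b :+ c :* c :+ d :* d)

  OrderedRootᵛ : Vec4 F → Set ℓ₂
  OrderedRootᵛ z = OrderedRoot F (z zero) (z (suc zero)) (z (suc (suc zero))) (z (suc (suc (suc zero))))

  OrderedRootᵛ-cong : ∀ {y z : Vec4 F} → (∀ i → y i ≈ z i) → OrderedRootᵛ y → OrderedRootᵛ z
  OrderedRootᵛ-cong y≈z (a≤0 , 0≤b , b≤c , c≤d , d≤a+b+c) =
      ≤-resp₂ (y≈z _) refl a≤0
    , ≤-resp₂ refl (y≈z _) 0≤b
    , ≤-resp₂ (y≈z _) (y≈z _) b≤c
    , ≤-resp₂ (y≈z _) (y≈z _) c≤d
    , ≤-resp₂ (y≈z _) (+-cong (+-cong (y≈z _) (y≈z _)) (y≈z _)) d≤a+b+c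

  Reflectable : Vec4 F → Set ℓ₂
  Reflectable w = 0# ≤ t × 0# ≤ p + (t + t) × p ≤ q × q ≤ r × r ≤ p + q + t
    where
    t p q r : Carrier
    t = w zero
    p = w (suc zero)
    q = w (suc (suc zero))
    r = w (suc (suc (suc zero)))

  reflect₀-orderedRoot : ∀ w → Reflectable w → OrderedRootᵛ (reflect₀ w)
  reflect₀-orderedRoot w (0≤t , 0≤p+2t , p≤q , q≤r , r≤p+q+t) =
    neg-nonpos 0≤t , 0≤p+2t , +-mono-≤ (t + t) p≤q , +-mono-≤ (t + t) q≤r , last
    where
    t p q r : Carrier
    t = w zero
    p = w (suc zero)
    q = w (suc (suc zero))
    r = w (suc (suc (suc zero)))
    last : r + (t + t) ≤ - t + (p + (t + t)) + (q + (t + t))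
    last = begin
      r + (t + t)                        ≤⟨ +-mono-≤ (t + t) r≤p+q+t ⟩
      p + q + t + (t + t)                ≈⟨ ≈-modulo-null (-‿inverseʳ t) (solve 4 (λ t p q n →
                                              p :+ q :+ t :+ (t :+ t) :+ (t :+ n) :* con 1
                                           := n :+ (p :+ (t :+ t)) :+ (q :+ (t :+ t)) :+ (t :+ n) :* con 0)
                                            refl t p q (- t)) ⟩
      - t + (p + (t + t)) + (q + (t + t))  ∎

  rootQuadruple-intro : ∀ y (σ : Permutation′ 4) {z} → (∀ j → z j ≈ y (σ ⟨$⟩ʳ j)) →
                        Descartes F z → OrderedRootᵛ z → RootQuadruple F y
  rootQuadruple-intro y σ z≈yσ D R =
    Descartes-unpermute σ y (Descartes-cong z≈yσ D) , σ , OrderedRootᵛ-cong z≈yσ R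

  Sperp-toFront : ∀ k y j →
                  reflect₀ (y ∘ (toFront k ⟨$⟩ʳ_)) j ≈ _·_ F (Sperp F k) y (toFront k ⟨$⟩ʳ j)
  Sperp-toFront zero y zero = trans (sym (-1*x≈-x _))
    (solve 5 (λ m a b c d → m :* b := con 0 :* a :+ m :* b :+ con 0 :* c :+ con 0 :* d) refl _ _ _ _ _)
  Sperp-toFront zero y (suc zero) =
    solve 4 (λ a b c d → a :+ (b :+ b) := con 1 :* a :+ con 2 :* b :+ con 0 :* c :+ con 0 :* d) refl _ _ _ _
  Sperp-toFront zero y (suc (suc zero)) =
    solve 4 (λ a b c d → c :+ (b :+ b) := con 0 :* a :+ con 2 :* b :+ con 1 :* c :+ con 0 :* d) refl _ _ _ _
  Sperp-toFront zero y (suc (suc (suc zero))) =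
    solve 4 (λ a b c d → d :+ (b :+ b) := con 0 :* a :+ con 2 :* b :+ con 0 :* c :+ con 1 :* d) refl _ _ _ _
  Sperp-toFront (suc zero) y zero = trans (sym (-1*x≈-x _))
    (solve 5 (λ m a b c d → m :* c := con 0 :* a :+ con 0 :* b :+ m :* c :+ con 0 :* d) refl _ _ _ _ _)
  Sperp-toFront (suc zero) y (suc zero) =
    solve 4 (λ a b c d → a :+ (c :+ c) := con 1 :* a :+ con 0 :* b :+ con 2 :* c :+ con 0 :* d) refl _ _ _ _
  Sperp-toFront (suc zero) y (suc (suc zero)) =
    solve 4 (λ a b c d → b :+ (c :+ c) := con 0 :* a :+ con 1 :* b :+ con 2 :* c :+ con 0 :* d) refl _ _ _ _
  Sperp-toFront (suc zero) y (suc (suc (suc zero))) =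
    solve 4 (λ a b c d → d :+ (c :+ c) := con 0 :* a :+ con 0 :* b :+ con 2 :* c :+ con 1 :* d) refl _ _ _ _
  Sperp-toFront (suc (suc zero)) y zero = trans (sym (-1*x≈-x _))
    (solve 5 (λ m a b c d → m :* d := con 0 :* a :+ con 0 :* b :+ con 0 :* c :+ m :* d) refl _ _ _ _ _)
  Sperp-toFront (suc (suc zero)) y (suc zero) =
    solve 4 (λ a b c d → a :+ (d :+ d) := con 1 :* a :+ con 0 :* b :+ con 0 :* c :+ con 2 :* d) refl _ _ _ _
  Sperp-toFront (suc (suc zero)) y (suc (suc zero)) =
    solve 4 (λ a b c d → b :+ (d :+ d) := con 0 :* a :+ con 1 :* b :+ con 0 :* c :+ con 2 :* d) refl _ _ _ _
  Sperp-toFront (suc (suc zero)) y (suc (suc (suc zero))) =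
    solve 4 (λ a b c d → c :+ (d :+ d) := con 0 :* a :+ con 0 :* b :+ con 1 :* c :+ con 2 :* d) refl _ _ _ _

  root-a+b-nonneg : ∀ {a b c d} → OrderedRoot F a b c d → 0# ≤ a + b
  root-a+b-nonneg {a} {b} {c} {d} (_ , _ , _ , c≤d , d≤a+b+c) = +-cancelʳ-≤ c (begin
    0# + c     ≈⟨ +-identityˡ c ⟩
    c          ≤⟨ c≤d ⟩
    d          ≤⟨ d≤a+b+c ⟩
    a + b + c  ∎)

  root-shift-nonneg : ∀ {a b c d t} → OrderedRoot F a b c d → b ≤ t → 0# ≤ a + (t + t)
  root-shift-nonneg {a} {b} {t = t} R@(_ , 0≤b , _) b≤t = begin
    0#           ≤⟨ root-a+b-nonneg R ⟩
    a + b        ≤⟨ +-monoˡ-≤ a b≤t ⟩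
    a + t        ≈⟨ +-identityʳ (a + t) ⟨
    a + t + 0#   ≤⟨ +-monoˡ-≤ (a + t) (≤-trans 0≤b b≤t) ⟩
    a + t + t    ≈⟨ +-assoc a t t ⟩
    a + (t + t)  ∎

  root-reflectable : ∀ {a b c d} → OrderedRoot F a b c d →
                     ∀ k → Reflectable (quad F a b c d ∘ (toFront k ⟨$⟩ʳ_))
  root-reflectable {a} {b} {c} R@(a≤0 , 0≤b , b≤c , c≤d , d≤a+b+c) zero =
    0≤b , root-shift-nonneg R ≤-refl , ≤-trans a≤0 (≤-trans 0≤b b≤c) , c≤d ,
    ≤-resp₂ refl (xy∙z≈xz∙y a b c) d≤a+b+c
  root-reflectable R@(a≤0 , 0≤b , b≤c , c≤d , d≤a+b+c) (suc zero) =
    ≤-trans 0≤b b≤c , root-shift-nonneg R b≤c , ≤-trans a≤0 0≤b , ≤-trans b≤c c≤d , d≤a+b+c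
  root-reflectable {a} {b} {c} {d} R@(a≤0 , 0≤b , b≤c , c≤d , d≤a+b+c) (suc (suc zero)) =
    ≤-trans (≤-trans 0≤b b≤c) c≤d , root-shift-nonneg R (≤-trans b≤c c≤d) ,
    ≤-trans a≤0 0≤b , b≤c ,
    (begin
      c          ≈⟨ +-identityˡ c ⟨
      0# + c     ≤⟨ +-mono₂-≤ (root-a+b-nonneg R) c≤d ⟩
      a + b + d  ∎)

mainTheorem11 : ∀ {c ℓ₁ ℓ₂ : Level} (F : OrderedField c ℓ₁ ℓ₂) →
    let open OrderedField F in
    (a b c d : Carrier) →
    Descartes F (quad F a b c d) → OrderedRoot F a b c d →
    (k : Fin 3) → RootQuadruple F (_·_ F (Sperp F k) (quad F a b c d))
mainTheorem11 F a b c d D R k =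
  rootQuadruple-intro F (_·_ F (Sperp F k) y) (toFront k) (Sperp-toFront F k y)
    (Descartes-reflect₀ F w (Descartes-permute F (toFront k) y D))
    (reflect₀-orderedRoot F w (root-reflectable F R k))
  where
  y w : Vec4 F
  y = quad F a b c d
  w = y ∘ (toFront k ⟨$⟩ʳ_)
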